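{- Let $\varepsilon>0$, let $i\ge 0$ and $p\ge 1$ be integers. Let $S_1,\dots,S_p$ be finite sets (repetitions allowed), each with $|S_k|\in[2^i,2^{i+1})$, and fix a linear order (deletion order) on the elements of $\bigcup_k S_k$. Independently for each $k$, choose an element $\tilde p(S_k)\in S_k$ uniformly at random, and let $\tilde i(S_k)\in\{1,\dots,|S_k|\}$ be the rank of $\tilde p(S_k)$ among the elements of $S_k$ with respect to the fixed order. Define $\tilde x_p(i)=\min\{\sum_{k\in K}\tilde i(S_k): K\subseteq\{1,\dots,p\},\ |K|\ge\frac{\varepsilon^2}{8}p\}$ (with the minimum over the empty family being $+\infty$). Then, for every choice of the sets and the order, $\mathbb{E}[\tilde x_p(i)]\ge\frac{\varepsilon^4}{1024}2^i p$.
   Context: This formalizes an adversary who chooses $p$ sets with sizes in $[2^i,2^{i+1})$ and a deletion order, then, after seeing the random pivots' ranks, selects a subcollection of at least $\frac{\varepsilon^2}{8}p$ sets to minimize the sum of the pivots' ranks.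
   Formalization: The parameter ε ranges over the positive rationals. -}

module Defs where

open import Data.Nat as ℕ using (ℕ; zero; suc; _≤?_)
open import Data.Bool using (Bool; true; false; if_then_else_)
open import Data.Fin using (Fin)
open import Data.Fin.Subset using (Subset; ∣_∣)
open import Data.Fin.Subset.Properties using (_∈?_)
open import Data.List as List using (List; []; _∷_; filter; length; allFin; concatMap; map)
open import Data.Vec as Vec using (Vec; []; _∷_)
open import Data.Maybe using (Maybe; just; nothing)
open import Data.Integer using (+_)
open import Data.Rational as ℚ using (ℚ; _/_)
open import Data.Rational.Properties as ℚP using ()
open import Relation.Nullary.Decidable using (does)
open import Function using (Injective)
open import Relation.Binary.PropositionalEquality using (_≡_)

ℕ→ℚ : ℕ → ℚ
ℕ→ℚ m = (+ m) / 1

-- The ground set is Fin n.  A linear ("deletion") order on it is given by an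
-- injective key function ord : Fin n → ℕ  (x precedes y iff ord x < ord y).

elems : ∀ {n} → Subset n → List (Fin n)
elems S = filter (_∈? S) (allFin _)

-- rank of x in S w.r.t. ord: number of elements y of S with ord y ≤ ord x
-- (for x ∈ S this lies in {1,…,|S|})
rank : ∀ {n} → (Fin n → ℕ) → Subset n → Fin n → ℕ
rank ord S x = length (filter (λ y → ord y ≤? ord x) (elems S))

-- all outcomes of the random pivot choice: one element of each S_k
-- (the uniform product distribution = uniform over this list)
outcomes : ∀ {n p} → Vec (Subset n) p → List (Vec (Fin n) p)
outcomes [] = [] ∷ []
outcomes (S ∷ Ss) = concatMap (λ x → map (x ∷_) (outcomes Ss)) (elems S)

allSubsets : ∀ p → List (Subset p)
allSubsets zero = [] ∷ []
allSubsets (suc p) = concatMap (λ K → (true ∷ K) ∷ (false ∷ K) ∷ []) (allSubsets p)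

sumOver : ∀ {p} → Subset p → Vec ℕ p → ℕ
sumOver [] [] = 0
sumOver (b ∷ K) (r ∷ rs) = (if b then r else 0) ℕ.+ sumOver K rs

-- ℕ ∪ {+∞}, with nothing = +∞
ℕ∞ : Set
ℕ∞ = Maybe ℕ

min∞ : ℕ∞ → ℕ∞ → ℕ∞
min∞ nothing y = y
min∞ x nothing = x
min∞ (just a) (just b) = just (ℕ._⊓_ a b)

add∞ : ℕ∞ → ℕ∞ → ℕ∞
add∞ (just a) (just b) = just (a ℕ.+ b)
add∞ _ _ = nothing

Feasible? : ℚ → ∀ p → Subset p → Bool
Feasible? ε p K = does (ℚP._≤?_ (ℚ._*_ (ℚ._*_ ε ε) (ℚ._*_ ((+ 1) / 8) (ℕ→ℚ p))) (ℕ→ℚ ∣ K ∣))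

xTilde : ℚ → ∀ {p} → Vec ℕ p → ℕ∞
xTilde ε {p} r =
  List.foldr (λ K acc → if Feasible? ε p K then min∞ (just (sumOver K r)) acc else acc)
             nothing (allSubsets p)

ranks : ∀ {n p} → (Fin n → ℕ) → Vec (Subset n) p → Vec (Fin n) p → Vec ℕ p
ranks ord Ss xs = Vec.zipWith (rank ord) Ss xs

-- Σ over all outcomes of x̃  (= E[x̃] · #outcomes), in ℕ ∪ {+∞}
totalXTilde : ℚ → ∀ {n p} → (Fin n → ℕ) → Vec (Subset n) p → ℕ∞
totalXTilde ε ord Ss =
  List.foldr (λ xs acc → add∞ (xTilde ε (ranks ord Ss xs)) acc) (just 0) (outcomes Ss)

-- "E[x̃] ≥ b", where E[x̃] = total / N with N = #outcomes > 0;
-- stated multiplied out: b · N ≤ total  (trivially true when total = +∞)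
ExpectationAtLeast : ℕ∞ → ℕ → ℚ → Set
ExpectationAtLeast nothing N b = Data.Unit.⊤ where import Data.Unit
ExpectationAtLeast (just t) N b = ℚ._≤_ (ℚ._*_ b (ℕ→ℚ N)) (ℕ→ℚ t)

-- Fix the threshold τ = ε² 2^i / 16 and charge a penalty τ to every pivot whose rank is
-- below τ, so that τ ≤ r + penalty τ r for every rank r.  For a feasible K, summing this
-- over K gives Σ_{k ∈ K} ĩ(S_k) ≥ τ |K| − Σ_k penalty ≥ τ ε² p / 8 − Σ_k penalty, hence
-- x̃ ≥ τ ε² p / 8 − Σ_k penalty.  At most τ elements of a set have rank below τ (the last
-- of them has rank at least their number), so the expected penalty of S_k is at most
-- τ² / |S_k| ≤ ε⁴ 2^i / 256, and by linearity the expected total penalty is at most half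
-- of τ ε² p / 8.  Thus E[x̃] ≥ ε⁴ 2^i p / 256.
module Submission where

open import Defs
open import Data.Bool using (if_then_else_)
open import Data.Fin using (Fin; zero; suc)
open import Data.Fin.Subset using (Subset; ∣_∣; inside; outside)
open import Data.Fin.Subset.Properties using (_∈?_)
open import Data.Integer as ℤ using (+_)
import Data.Integer.Properties as ℤP
open import Data.List as List using (List; []; _∷_; length; filter; map; concatMap)
import Data.List.Properties as ListP
open import Data.List.Relation.Unary.All as All using (All; _∷_)
open import Data.List.Relation.Unary.All.Properties using (all-filter)
open import Data.Maybe using (just; nothing)
open import Data.Nat as ℕ using (ℕ; zero; suc; _^_)
import Data.Nat.Coprimality as Coprimality
import Data.Nat.Properties as ℕP
open import Data.List.Extrema ℕP.≤-totalOrder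
  using (argmax; argmax-all; f[⊥]≤f[argmax]; f[xs]≤f[argmax])
open import Data.Product using (_×_; proj₁)
open import Data.Rational as ℚ using (ℚ; mkℚ; 0ℚ; 1ℚ; _+_; _-_; _*_; _/_; _≤_; _<_; _≤?_)
import Data.Rational.Properties as ℚP
open import Data.Rational.Solver using (module +-*-Solver)
import Data.Rational.Unnormalised as ℚᵘ
import Data.Rational.Unnormalised.Properties as ℚᵘP
open import Data.Sum using ([_,_]′)
open import Data.Unit using (⊤; tt)
open import Data.Vec as Vec using (Vec; []; _∷_)
open import Function using (Injective; _∘_)
open import Relation.Nullary using (yes; no; does; contradiction)
open import Relation.Unary using (Decidable)
open import Relation.Binary.PropositionalEquality

open +-*-Solver using (solve; _:=_; _:+_; _:-_; _:*_; con)

private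
  variable
    A : Set
    n p : ℕ

private
  integral : ℕ → ℚ
  integral m = mkℚ (+ m) 0 (Coprimality.sym (Coprimality.1-coprimeTo m))

  ℕ→ℚ≡integral : ∀ m → ℕ→ℚ m ≡ integral m
  ℕ→ℚ≡integral m = ℚP.↥p/↧p≡p (integral m)

ℕ→ℚ-+ : ∀ a b → ℕ→ℚ (a ℕ.+ b) ≡ ℕ→ℚ a + ℕ→ℚ b
ℕ→ℚ-+ a b rewrite ℕ→ℚ≡integral a | ℕ→ℚ≡integral b | ℕ→ℚ≡integral (a ℕ.+ b) =
  ℚP.toℚᵘ-injective
    (ℚᵘP.≃-trans (ℚᵘ.*≡* (cong (ℤ._* + 1) +[a+b]≡+a*1++b*1))
                 (ℚᵘP.≃-sym (ℚP.toℚᵘ-homo-+ (integral a) (integral b))))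
  where
  +[a+b]≡+a*1++b*1 : + (a ℕ.+ b) ≡ + a ℤ.* + 1 ℤ.+ + b ℤ.* + 1
  +[a+b]≡+a*1++b*1 = trans (ℤP.pos-+ a b)
                       (sym (cong₂ ℤ._+_ (ℤP.*-identityʳ (+ a)) (ℤP.*-identityʳ (+ b))))

ℕ→ℚ-suc : ∀ m → ℕ→ℚ (suc m) ≡ 1ℚ + ℕ→ℚ m
ℕ→ℚ-suc = ℕ→ℚ-+ 1

ℕ→ℚ-* : ∀ a b → ℕ→ℚ (a ℕ.* b) ≡ ℕ→ℚ a * ℕ→ℚ b
ℕ→ℚ-* zero    b = sym (ℚP.*-zeroˡ (ℕ→ℚ b))
ℕ→ℚ-* (suc a) b = begin
  ℕ→ℚ (b ℕ.+ a ℕ.* b)    ≡⟨ ℕ→ℚ-+ b (a ℕ.* b) ⟩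
  ℕ→ℚ b + ℕ→ℚ (a ℕ.* b)  ≡⟨ cong (_+_ (ℕ→ℚ b)) (ℕ→ℚ-* a b) ⟩
  ℕ→ℚ b + ℕ→ℚ a * ℕ→ℚ b  ≡⟨ solve 2 (λ a b → b :+ a :* b := (con 1ℚ :+ a) :* b)
                                 refl (ℕ→ℚ a) (ℕ→ℚ b) ⟩
  (1ℚ + ℕ→ℚ a) * ℕ→ℚ b   ≡⟨ cong (_* ℕ→ℚ b) (ℕ→ℚ-suc a) ⟨
  ℕ→ℚ (suc a) * ℕ→ℚ b    ∎
  where open ≡-Reasoning

ℕ→ℚ-nonNeg : ∀ m → 0ℚ ≤ ℕ→ℚ m
ℕ→ℚ-nonNeg m rewrite ℕ→ℚ≡integral m = ℚP.nonNegative⁻¹ (integral m)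

ℕ→ℚ-mono-≤ : ∀ {a b} → a ℕ.≤ b → ℕ→ℚ a ≤ ℕ→ℚ b
ℕ→ℚ-mono-≤ {a} {b} a≤b rewrite ℕ→ℚ≡integral a | ℕ→ℚ≡integral b =
  ℚ.*≤* (ℤP.*-monoʳ-≤-nonNeg (+ 1) (ℤ.+≤+ a≤b))

*-nonNeg : ∀ {x y} → 0ℚ ≤ x → 0ℚ ≤ y → 0ℚ ≤ x * y
*-nonNeg {x} {y} 0≤x 0≤y =
  ℚP.nonNegative⁻¹ (x * y) {{ℚP.nonNeg*nonNeg⇒nonNeg x {{ℚ.nonNegative 0≤x}} y {{ℚ.nonNegative 0≤y}}}}

*-monoˡ-≤ : ∀ {r x y} → 0ℚ ≤ r → x ≤ y → r * x ≤ r * y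
*-monoˡ-≤ {r} 0≤r = ℚP.*-monoˡ-≤-nonNeg r {{ℚ.nonNegative 0≤r}}

*-monoʳ-≤ : ∀ {r x y} → 0ℚ ≤ r → x ≤ y → x * r ≤ y * r
*-monoʳ-≤ {r} 0≤r = ℚP.*-monoʳ-≤-nonNeg r {{ℚ.nonNegative 0≤r}}

x≤y+x : ∀ {x} y → 0ℚ ≤ y → x ≤ y + x
x≤y+x {x} y 0≤y = subst (_≤ y + x) (ℚP.+-identityˡ x) (ℚP.+-monoˡ-≤ x 0≤y)

x≤y+z⇒x-z≤y : ∀ {x y z} → x ≤ y + z → x - z ≤ y
x≤y+z⇒x-z≤y {x} {y} {z} x≤y+z =
  subst (x - z ≤_) (solve 2 (λ y z → y :+ z :- z := y) refl y z) (ℚP.+-monoˡ-≤ (ℚ.- z) x≤y+z)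

+-interchange : ∀ a b c d → (a + b) + (c + d) ≡ (a + c) + (b + d)
+-interchange = solve 4 (λ a b c d → (a :+ b) :+ (c :+ d) := (a :+ c) :+ (b :+ d)) refl

∑ : (A → ℚ) → List A → ℚ
∑ f []       = 0ℚ
∑ f (x ∷ xs) = f x + ∑ f xs

module _ {f g : A → ℚ} where

  ∑-cong : (∀ x → f x ≡ g x) → ∀ xs → ∑ f xs ≡ ∑ g xs
  ∑-cong f≗g []       = refl
  ∑-cong f≗g (x ∷ xs) = cong₂ _+_ (f≗g x) (∑-cong f≗g xs)

  ∑-distrib-+ : ∀ xs → ∑ (λ x → f x + g x) xs ≡ ∑ f xs + ∑ g xs
  ∑-distrib-+ []       = sym (ℚP.+-identityˡ 0ℚ)
  ∑-distrib-+ (x ∷ xs) = trans (cong (_+_ (f x + g x)) (∑-distrib-+ xs))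
                               (+-interchange (f x) (g x) (∑ f xs) (∑ g xs))

  ∑-distrib-- : ∀ xs → ∑ (λ x → f x - g x) xs ≡ ∑ f xs - ∑ g xs
  ∑-distrib-- []       = refl
  ∑-distrib-- (x ∷ xs) = trans (cong (_+_ (f x - g x)) (∑-distrib-- xs))
    (solve 4 (λ a b c d → (a :- b) :+ (c :- d) := (a :+ c) :- (b :+ d)) refl
       (f x) (g x) (∑ f xs) (∑ g xs))

∑-const : ∀ c (xs : List A) → ∑ (λ _ → c) xs ≡ c * ℕ→ℚ (length xs)
∑-const c []       = sym (ℚP.*-zeroʳ c)
∑-const c (x ∷ xs) = begin
  c + ∑ (λ _ → c) xs          ≡⟨ cong (_+_ c) (∑-const c xs) ⟩
  c + c * ℕ→ℚ (length xs)     ≡⟨ solve 2 (λ c m → c :+ c :* m := c :* (con 1ℚ :+ m))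
                                       refl c (ℕ→ℚ (length xs)) ⟩
  c * (1ℚ + ℕ→ℚ (length xs))  ≡⟨ cong (c *_) (ℕ→ℚ-suc (length xs)) ⟨
  c * ℕ→ℚ (suc (length xs))   ∎
  where open ≡-Reasoning

∑-*ʳ : ∀ (f : A → ℚ) c xs → ∑ (λ x → f x * c) xs ≡ ∑ f xs * c
∑-*ʳ f c []       = sym (ℚP.*-zeroˡ c)
∑-*ʳ f c (x ∷ xs) = trans (cong (_+_ (f x * c)) (∑-*ʳ f c xs)) (sym (ℚP.*-distribʳ-+ c (f x) (∑ f xs)))

∑-concatMap : ∀ {B : Set} (f : B → ℚ) (g : A → List B) xs → ∑ f (concatMap g xs) ≡ ∑ (∑ f ∘ g) xs
∑-concatMap f g []       = refl
∑-concatMap f g (x ∷ xs) = trans (∑-++ (g x)) (cong (_+_ (∑ f (g x))) (∑-concatMap f g xs))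
  where
  ∑-++ : ∀ ys {zs} → ∑ f (ys List.++ zs) ≡ ∑ f ys + ∑ f zs
  ∑-++ []       = sym (ℚP.+-identityˡ _)
  ∑-++ (y ∷ ys) = trans (cong (_+_ (f y)) (∑-++ ys)) (sym (ℚP.+-assoc (f y) _ _))

∑-map : ∀ {B : Set} (f : B → ℚ) (g : A → B) xs → ∑ f (map g xs) ≡ ∑ (f ∘ g) xs
∑-map f g []       = refl
∑-map f g (x ∷ xs) = cong (_+_ (f (g x))) (∑-map f g xs)

length-filter-tabulate : ∀ {P : A → Set} (P? : Decidable P) (h : Fin n → A) (S : Subset n) →
  (∀ x → does (P? (h x)) ≡ does (x ∈? S)) → length (filter P? (List.tabulate h)) ≡ ∣ S ∣
length-filter-tabulate P? h []            agree = refl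
length-filter-tabulate P? h (inside ∷ S)  agree with P? (h zero) | agree zero
... | yes _ | _ = cong suc (length-filter-tabulate P? (h ∘ suc) S (agree ∘ suc))
length-filter-tabulate P? h (outside ∷ S) agree with P? (h zero) | agree zero
... | no _  | _ = length-filter-tabulate P? (h ∘ suc) S (agree ∘ suc)

length-elems : ∀ (S : Subset n) → length (elems S) ≡ ∣ S ∣
length-elems S = length-filter-tabulate (_∈? S) (λ x → x) S (λ _ → refl)

length-filter-≤ : ∀ {P Q : A → Set} (P? : Decidable P) (Q? : Decidable Q) xs →
  All Q (filter P? xs) → length (filter P? xs) ℕ.≤ length (filter Q? xs)
length-filter-≤ P? Q? []       _ = ℕ.z≤n
length-filter-≤ P? Q? (x ∷ xs) allQ with P? x | Q? x
... | yes _ | yes _  = ℕ.s≤s (length-filter-≤ P? Q? xs (All.tail allQ))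
... | yes _ | no ¬qx = contradiction (All.head allQ) ¬qx
... | no  _ | yes _  = ℕP.m≤n⇒m≤1+n (length-filter-≤ P? Q? xs allQ)
... | no  _ | no  _  = length-filter-≤ P? Q? xs allQ

length-outcomes-∷ : ∀ (S : Subset n) (Ss : Vec (Subset n) p) →
  length (outcomes (S ∷ Ss)) ≡ length (elems S) ℕ.* length (outcomes Ss)
length-outcomes-∷ S Ss = go (elems S)
  where
  go : ∀ xs → length (concatMap (λ x → map (x ∷_) (outcomes Ss)) xs) ≡ length xs ℕ.* length (outcomes Ss)
  go []       = refl
  go (x ∷ xs) = trans (ListP.length-++ (map (x ∷_) (outcomes Ss)))
                      (cong₂ ℕ._+_ (ListP.length-map (x ∷_) (outcomes Ss)) (go xs))

∑-outcomes-∷ : ∀ (f : Vec (Fin n) (suc p) → ℚ) S Ss →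
  ∑ f (outcomes (S ∷ Ss)) ≡ ∑ (λ x → ∑ (f ∘ (x ∷_)) (outcomes Ss)) (elems S)
∑-outcomes-∷ f S Ss = trans (∑-concatMap f (λ x → map (x ∷_) (outcomes Ss)) (elems S))
                            (∑-cong (λ x → ∑-map f (x ∷_) (outcomes Ss)) (elems S))

∑-outcomes-ranks-∷ : ∀ (h : ℕ → ℚ) (ord : Fin n → ℕ) S (Ss : Vec (Subset n) p) →
  ∑ (∑ h ∘ Vec.toList ∘ ranks ord (S ∷ Ss)) (outcomes (S ∷ Ss))
    ≡ ∑ (h ∘ rank ord S) (elems S) * ℕ→ℚ (length (outcomes Ss))
      + ∑ (∑ h ∘ Vec.toList ∘ ranks ord Ss) (outcomes Ss) * ℕ→ℚ (length (elems S))
∑-outcomes-ranks-∷ h ord S Ss = begin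
  ∑ G (outcomes (S ∷ Ss))                                  ≡⟨ ∑-outcomes-∷ G S Ss ⟩
  ∑ (λ x → ∑ (λ ys → hS x + G′ ys) O) (elems S)            ≡⟨ ∑-cong inner (elems S) ⟩
  ∑ (λ x → hS x * N + ∑ G′ O) (elems S)                    ≡⟨ ∑-distrib-+ {f = λ x → hS x * N} (elems S) ⟩
  ∑ (λ x → hS x * N) (elems S) + ∑ (λ _ → ∑ G′ O) (elems S)
    ≡⟨ cong₂ _+_ (∑-*ʳ hS N (elems S)) (∑-const (∑ G′ O) (elems S)) ⟩
  ∑ hS (elems S) * N + ∑ G′ O * ℕ→ℚ (length (elems S))    ∎
  where
  open ≡-Reasoning
  hS = h ∘ rank ord S
  G  = ∑ h ∘ Vec.toList ∘ ranks ord (S ∷ Ss)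
  G′ = ∑ h ∘ Vec.toList ∘ ranks ord Ss
  O  = outcomes Ss
  N  = ℕ→ℚ (length O)
  inner : ∀ x → ∑ (λ ys → hS x + G′ ys) O ≡ hS x * N + ∑ G′ O
  inner x = trans (∑-distrib-+ {f = λ _ → hS x} O) (cong (_+ ∑ G′ O) (∑-const (hS x) O))

∑-outcomes-ranks-≤ : ∀ (h : ℕ → ℚ) B (ord : Fin n → ℕ) (S : Vec (Subset n) p) →
  (∀ k → ∑ (h ∘ rank ord (Vec.lookup S k)) (elems (Vec.lookup S k))
           ≤ B * ℕ→ℚ (length (elems (Vec.lookup S k)))) →
  ∑ (∑ h ∘ Vec.toList ∘ ranks ord S) (outcomes S) ≤ B * ℕ→ℚ p * ℕ→ℚ (length (outcomes S))
∑-outcomes-ranks-≤ h B ord [] _ =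
  ℚP.≤-reflexive (solve 1 (λ B → con 0ℚ :+ con 0ℚ := B :* con 0ℚ :* con 1ℚ) refl B)
∑-outcomes-ranks-≤ {p = suc p} h B ord (S ∷ Ss) bounded = begin
  ∑ (∑ h ∘ Vec.toList ∘ ranks ord (S ∷ Ss)) (outcomes (S ∷ Ss))
    ≡⟨ ∑-outcomes-ranks-∷ h ord S Ss ⟩
  ∑ (h ∘ rank ord S) (elems S) * N + ∑ (∑ h ∘ Vec.toList ∘ ranks ord Ss) (outcomes Ss) * a
    ≤⟨ ℚP.+-mono-≤ (*-monoʳ-≤ 0≤N (bounded zero))
                   (*-monoʳ-≤ 0≤a (∑-outcomes-ranks-≤ h B ord Ss (bounded ∘ suc))) ⟩
  B * a * N + B * ℕ→ℚ p * N * a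
    ≡⟨ solve 4 (λ B a N P → B :* a :* N :+ B :* P :* N :* a := B :* (con 1ℚ :+ P) :* (a :* N))
         refl B a N (ℕ→ℚ p) ⟩
  B * (1ℚ + ℕ→ℚ p) * (a * N)
    ≡⟨ cong₂ (λ u v → B * u * v) (ℕ→ℚ-suc p) length-outcomes ⟨
  B * ℕ→ℚ (suc p) * ℕ→ℚ (length (outcomes (S ∷ Ss))) ∎
  where
  open ℚP.≤-Reasoning
  a = ℕ→ℚ (length (elems S))
  N = ℕ→ℚ (length (outcomes Ss))
  0≤a = ℕ→ℚ-nonNeg (length (elems S))
  0≤N = ℕ→ℚ-nonNeg (length (outcomes Ss))
  length-outcomes : ℕ→ℚ (length (outcomes (S ∷ Ss))) ≡ a * N
  length-outcomes = trans (cong ℕ→ℚ (length-outcomes-∷ S Ss))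
                          (ℕ→ℚ-* (length (elems S)) (length (outcomes Ss)))

-- Kept opaque: `with` normalises its goal, and normalising ℕ→ℚ of an open term does not finish.
opaque
  below? : (τ : ℚ) → Decidable (λ r → ℕ→ℚ r < τ)
  below? τ r = ℕ→ℚ r ℚ.<? τ

penalty : ℚ → ℕ → ℚ
penalty τ r = if does (below? τ r) then τ else 0ℚ

≤-+penalty : ∀ τ r → τ ≤ ℕ→ℚ r + penalty τ r
≤-+penalty τ r with below? τ r
... | yes _   = x≤y+x (ℕ→ℚ r) (ℕ→ℚ-nonNeg r)
... | no  r≮τ = subst (τ ≤_) (sym (ℚP.+-identityʳ (ℕ→ℚ r))) (ℚP.≮⇒≥ r≮τ)

penalty-nonNeg : ∀ {τ} r → 0ℚ ≤ τ → 0ℚ ≤ penalty τ r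
penalty-nonNeg {τ} r 0≤τ with below? τ r
... | yes _ = 0≤τ
... | no  _ = ℚP.≤-refl

∑-penalty : ∀ τ (f : A → ℕ) xs → ∑ (penalty τ ∘ f) xs ≡ ∑ (λ _ → τ) (filter (below? τ ∘ f) xs)
∑-penalty τ f []       = refl
∑-penalty τ f (x ∷ xs) with below? τ (f x)
... | yes _ = cong (_+_ τ) (∑-penalty τ f xs)
... | no  _ = trans (ℚP.+-identityˡ _) (∑-penalty τ f xs)

-- The ord-largest element b of rank below τ is preceded by all the others, so their
-- number is at most rank b < τ.
length-below≤ : ∀ {τ} (ord : Fin n → ℕ) (S : Subset n) → 0ℚ ≤ τ →
  ℕ→ℚ (length (filter (below? τ ∘ rank ord S) (elems S))) ≤ τ
length-below≤ {τ = τ} ord S 0≤τ = bound _ refl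
  where
  bound : ∀ zs → zs ≡ filter (below? τ ∘ rank ord S) (elems S) → ℕ→ℚ (length zs) ≤ τ
  bound []       _  = 0≤τ
  bound (y ∷ ys) eq = ℚP.≤-trans (ℕ→ℚ-mono-≤ count≤rank[b]) (ℚP.<⇒≤ b-below)
    where
    b = argmax ord y ys
    all-below : All (λ x → ℕ→ℚ (rank ord S x) < τ) (y ∷ ys)
    all-below = subst (All _) (sym eq) (all-filter (below? τ ∘ rank ord S) (elems S))
    b-below : ℕ→ℚ (rank ord S b) < τ
    b-below = argmax-all ord (All.head all-below) (All.tail all-below)
    all-precede-b : All (λ z → ord z ℕ.≤ ord b) (y ∷ ys)
    all-precede-b = f[⊥]≤f[argmax] {f = ord} y ys ∷ f[xs]≤f[argmax] {f = ord} y ys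
    count≤rank[b] : length (y ∷ ys) ℕ.≤ rank ord S b
    count≤rank[b] = subst (λ zs → length zs ℕ.≤ rank ord S b) (sym eq)
      (length-filter-≤ (below? τ ∘ rank ord S) (λ z → ord z ℕ.≤? ord b) (elems S)
        (subst (All (λ z → ord z ℕ.≤ ord b)) eq all-precede-b))

∑-penalty-rank≤ : ∀ {τ} (ord : Fin n → ℕ) (S : Subset n) → 0ℚ ≤ τ →
  ∑ (penalty τ ∘ rank ord S) (elems S) ≤ τ * τ
∑-penalty-rank≤ {τ = τ} ord S 0≤τ = begin
  ∑ (penalty τ ∘ rank ord S) (elems S)     ≡⟨ ∑-penalty τ (rank ord S) (elems S) ⟩
  ∑ (λ _ → τ) below                        ≡⟨ ∑-const τ below ⟩
  τ * ℕ→ℚ (length below)                   ≤⟨ *-monoˡ-≤ 0≤τ (length-below≤ ord S 0≤τ) ⟩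
  τ * τ                                    ∎
  where
  open ℚP.≤-Reasoning
  below = filter (below? τ ∘ rank ord S) (elems S)

∑-penalty-rank≤-scaled : ∀ {c s} (ord : Fin n → ℕ) (S : Subset n) →
  0ℚ ≤ c → s ℕ.≤ length (elems S) →
  ∑ (penalty (c * ℕ→ℚ s) ∘ rank ord S) (elems S) ≤ c * c * ℕ→ℚ s * ℕ→ℚ (length (elems S))
∑-penalty-rank≤-scaled {c = c} {s} ord S 0≤c s≤∣S∣ = begin
  ∑ (penalty (c * ℕ→ℚ s) ∘ rank ord S) (elems S)
    ≤⟨ ∑-penalty-rank≤ ord S (*-nonNeg 0≤c (ℕ→ℚ-nonNeg s)) ⟩
  c * ℕ→ℚ s * (c * ℕ→ℚ s)
    ≡⟨ solve 2 (λ c s → c :* s :* (c :* s) := c :* c :* s :* s) refl c (ℕ→ℚ s) ⟩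
  c * c * ℕ→ℚ s * ℕ→ℚ s
    ≤⟨ *-monoˡ-≤ 0≤c²s (ℕ→ℚ-mono-≤ s≤∣S∣) ⟩
  c * c * ℕ→ℚ s * ℕ→ℚ (length (elems S))
    ∎
  where
  open ℚP.≤-Reasoning
  0≤c²s = *-nonNeg (*-nonNeg 0≤c 0≤c) (ℕ→ℚ-nonNeg s)

infix 4 _≤∞_

_≤∞_ : ℚ → ℕ∞ → Set
q ≤∞ nothing = ⊤
q ≤∞ just v  = q ≤ ℕ→ℚ v

≤∞-min∞ : ∀ {q} a b → q ≤∞ a → q ≤∞ b → q ≤∞ min∞ a b
≤∞-min∞     nothing  b        _   q≤b = q≤b
≤∞-min∞     (just a) nothing  q≤a _   = q≤a
≤∞-min∞ {q} (just a) (just b) q≤a q≤b =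
  [ (λ a⊓b≡a → subst (λ m → q ≤ ℕ→ℚ m) (sym a⊓b≡a) q≤a)
  , (λ a⊓b≡b → subst (λ m → q ≤ ℕ→ℚ m) (sym a⊓b≡b) q≤b) ]′ (ℕP.⊓-sel a b)

≤∞-add∞ : ∀ {q r} a b → q ≤∞ a → r ≤∞ b → q + r ≤∞ add∞ a b
≤∞-add∞ (just a) (just b) q≤a r≤b = subst (_ ≤_) (sym (ℕ→ℚ-+ a b)) (ℚP.+-mono-≤ q≤a r≤b)
≤∞-add∞ (just _) nothing  _   _   = tt
≤∞-add∞ nothing  _        _   _   = tt

∑≤∞-sum∞ : ∀ (f : A → ℚ) (g : A → ℕ∞) → (∀ x → f x ≤∞ g x) →
  ∀ xs → ∑ f xs ≤∞ List.foldr (λ x acc → add∞ (g x) acc) (just 0) xs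
∑≤∞-sum∞ f g f≤g []       = ℚP.≤-refl
∑≤∞-sum∞ f g f≤g (x ∷ xs) = ≤∞-add∞ (g x) _ (f≤g x) (∑≤∞-sum∞ f g f≤g xs)

≤∞-min∞-filter : ∀ {P : A → Set} {q} (P? : Decidable P) (g : A → ℕ) →
  (∀ {x} → P x → q ≤ ℕ→ℚ (g x)) →
  ∀ xs → q ≤∞ List.foldr (λ x acc → if does (P? x) then min∞ (just (g x)) acc else acc) nothing xs
≤∞-min∞-filter P? g q≤g []       = tt
≤∞-min∞-filter P? g q≤g (x ∷ xs) with P? x
... | yes px = ≤∞-min∞ (just (g x)) _ (q≤g px) (≤∞-min∞-filter P? g q≤g xs)
... | no  _  = ≤∞-min∞-filter P? g q≤g xs

feasibleSize : ℚ → ℕ → ℚ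
feasibleSize ε p = ε * ε * ((+ 1) / 8 * ℕ→ℚ p)

penalties : ℚ → Vec ℕ p → ℚ
penalties τ r = ∑ (penalty τ) (Vec.toList r)

sumOver-≥ : ∀ {τ} → 0ℚ ≤ τ → (K : Subset p) (r : Vec ℕ p) →
  τ * ℕ→ℚ ∣ K ∣ ≤ ℕ→ℚ (sumOver K r) + penalties τ r
sumOver-≥ {τ = τ} 0≤τ []            []      = ℚP.≤-reflexive (ℚP.*-zeroʳ τ)
sumOver-≥ {τ = τ} 0≤τ (inside ∷ K)  (x ∷ r) = begin
  τ * ℕ→ℚ (suc ∣ K ∣)
    ≡⟨ cong (τ *_) (ℕ→ℚ-suc ∣ K ∣) ⟩
  τ * (1ℚ + ℕ→ℚ ∣ K ∣)
    ≡⟨ solve 2 (λ τ k → τ :* (con 1ℚ :+ k) := τ :+ τ :* k) refl τ (ℕ→ℚ ∣ K ∣) ⟩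
  τ + τ * ℕ→ℚ ∣ K ∣
    ≤⟨ ℚP.+-mono-≤ (≤-+penalty τ x) (sumOver-≥ 0≤τ K r) ⟩
  (ℕ→ℚ x + penalty τ x) + (ℕ→ℚ (sumOver K r) + penalties τ r)
    ≡⟨ +-interchange (ℕ→ℚ x) (penalty τ x) (ℕ→ℚ (sumOver K r)) (penalties τ r) ⟩
  (ℕ→ℚ x + ℕ→ℚ (sumOver K r)) + penalties τ (x ∷ r)
    ≡⟨ cong (_+ penalties τ (x ∷ r)) (ℕ→ℚ-+ x (sumOver K r)) ⟨
  ℕ→ℚ (x ℕ.+ sumOver K r) + penalties τ (x ∷ r)
    ∎
  where open ℚP.≤-Reasoning
sumOver-≥ {τ = τ} 0≤τ (outside ∷ K) (x ∷ r) =
  ℚP.≤-trans (sumOver-≥ 0≤τ K r)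
    (ℚP.+-monoʳ-≤ (ℕ→ℚ (sumOver K r)) (x≤y+x (penalty τ x) (penalty-nonNeg x 0≤τ)))

xTilde-≥ : ∀ ε {τ} → 0ℚ ≤ τ → (r : Vec ℕ p) → τ * feasibleSize ε p - penalties τ r ≤∞ xTilde ε r
xTilde-≥ {p} ε {τ} 0≤τ r =
  ≤∞-min∞-filter (λ K → feasibleSize ε p ≤? ℕ→ℚ ∣ K ∣) (λ K → sumOver K r)
    (λ {K} → feasible⇒ {K}) (allSubsets p)
  where
  feasible⇒ : ∀ {K : Subset p} → feasibleSize ε p ≤ ℕ→ℚ ∣ K ∣ →
    τ * feasibleSize ε p - penalties τ r ≤ ℕ→ℚ (sumOver K r)
  feasible⇒ {K} F≤∣K∣ = x≤y+z⇒x-z≤y (ℚP.≤-trans (*-monoˡ-≤ 0≤τ F≤∣K∣) (sumOver-≥ 0≤τ K r))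

totalXTilde-≥ : ∀ ε {τ} → 0ℚ ≤ τ → (ord : Fin n → ℕ) (S : Vec (Subset n) p) →
  τ * feasibleSize ε p * ℕ→ℚ (length (outcomes S)) - ∑ (penalties τ ∘ ranks ord S) (outcomes S)
    ≤∞ totalXTilde ε ord S
totalXTilde-≥ {p = p} ε {τ} 0≤τ ord S =
  subst (_≤∞ totalXTilde ε ord S) ∑≡
    (∑≤∞-sum∞ _ (xTilde ε ∘ ranks ord S) (xTilde-≥ ε 0≤τ ∘ ranks ord S) (outcomes S))
  where
  ∑≡ : ∑ (λ xs → τ * feasibleSize ε p - penalties τ (ranks ord S xs)) (outcomes S)
     ≡ τ * feasibleSize ε p * ℕ→ℚ (length (outcomes S)) - ∑ (penalties τ ∘ ranks ord S) (outcomes S)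
  ∑≡ = trans (∑-distrib-- (outcomes S)) (cong (_- _) (∑-const (τ * feasibleSize ε p) (outcomes S)))

≤∞⇒ExpectationAtLeast : ∀ m {q b N} → q ≤∞ m → b * ℕ→ℚ N ≤ q → ExpectationAtLeast m N b
≤∞⇒ExpectationAtLeast nothing  _   _    = tt
≤∞⇒ExpectationAtLeast (just t) q≤t bN≤q = ℚP.≤-trans bN≤q q≤t

-- With τ = ε² s / 16 the main term τ F = ε⁴ s P / 128 is twice the penalty budget
-- ε⁴ s P / 256, which in turn is four times the target ε⁴ s P / 1024.
lowerBound-arithmetic : ∀ ε s P N Π → 0ℚ ≤ ε → 0ℚ ≤ s → 0ℚ ≤ P → 0ℚ ≤ N →
  Π ≤ ε * ε * ((+ 1) / 16) * (ε * ε * ((+ 1) / 16)) * s * P * N →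
  (ε * ε * ε * ε) * ((+ 1) / 1024) * s * P * N ≤ ε * ε * ((+ 1) / 16) * s * (ε * ε * ((+ 1) / 8 * P)) * N - Π
lowerBound-arithmetic ε s P N Π 0≤ε 0≤s 0≤P 0≤N Π≤ = begin
  (ε * ε * ε * ε) * ((+ 1) / 1024) * s * P * N
    ≤⟨ x≤y+x slack 0≤slack ⟩
  slack + (ε * ε * ε * ε) * ((+ 1) / 1024) * s * P * N
    ≡⟨ solve 4 (λ ε s P N →
         ε :* ε :* (ε :* ε) :* con ((+ 3) / 1024) :* s :* P :* N
           :+ (ε :* ε :* ε :* ε) :* con ((+ 1) / 1024) :* s :* P :* N
         := ε :* ε :* con ((+ 1) / 16) :* s :* (ε :* ε :* (con ((+ 1) / 8) :* P)) :* N
           :- ε :* ε :* con ((+ 1) / 16) :* (ε :* ε :* con ((+ 1) / 16)) :* s :* P :* N)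
         refl ε s P N ⟩
  τFN - ε * ε * ((+ 1) / 16) * (ε * ε * ((+ 1) / 16)) * s * P * N
    ≤⟨ ℚP.+-monoʳ-≤ τFN (ℚP.neg-antimono-≤ Π≤) ⟩
  τFN - Π ∎
  where
  open ℚP.≤-Reasoning
  slack = ε * ε * (ε * ε) * ((+ 3) / 1024) * s * P * N
  τFN   = ε * ε * ((+ 1) / 16) * s * (ε * ε * ((+ 1) / 8 * P)) * N
  0≤ε²  = *-nonNeg 0≤ε 0≤ε
  0≤slack : 0ℚ ≤ slack
  0≤slack = *-nonNeg (*-nonNeg (*-nonNeg (*-nonNeg (*-nonNeg 0≤ε² 0≤ε²)
              (ℚP.nonNegative⁻¹ ((+ 3) / 1024))) 0≤s) 0≤P) 0≤N

lemma7 : (ε : ℚ) → 0ℚ < ε → (i p : ℕ) → 1 ℕ.≤ p →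
    (n : ℕ) (ord : Fin n → ℕ) → Injective _≡_ _≡_ ord →
    (S : Vec (Subset n) p) →
    (∀ k → (2 ^ i ℕ.≤ ∣ Vec.lookup S k ∣) × (∣ Vec.lookup S k ∣ ℕ.< 2 ^ (ℕ.suc i))) →
    ExpectationAtLeast (totalXTilde ε ord S) (length (outcomes S))
      ((ε * ε * ε * ε) * ((+ 1) / 1024) * ℕ→ℚ (2 ^ i) * ℕ→ℚ p)
lemma7 ε 0<ε i p _ n ord _ S sizes =
  ≤∞⇒ExpectationAtLeast (totalXTilde ε ord S) (totalXTilde-≥ ε 0≤τ ord S)
    (lowerBound-arithmetic ε s (ℕ→ℚ p) (ℕ→ℚ (length (outcomes S))) _ 0≤ε
      (ℕ→ℚ-nonNeg (2 ^ i)) (ℕ→ℚ-nonNeg p) (ℕ→ℚ-nonNeg (length (outcomes S)))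
      (∑-outcomes-ranks-≤ (penalty τ) (c * c * s) ord S
        (λ k → ∑-penalty-rank≤-scaled ord (Vec.lookup S k) 0≤c (2^i≤size k))))
  where
  s = ℕ→ℚ (2 ^ i)
  c = ε * ε * ((+ 1) / 16)
  τ = c * s
  0≤ε = ℚP.<⇒≤ 0<ε
  0≤c = *-nonNeg (*-nonNeg 0≤ε 0≤ε) (ℚP.nonNegative⁻¹ ((+ 1) / 16))
  0≤τ = *-nonNeg 0≤c (ℕ→ℚ-nonNeg (2 ^ i))
  2^i≤size : ∀ k → 2 ^ i ℕ.≤ length (elems (Vec.lookup S k))
  2^i≤size k = subst (2 ^ i ℕ.≤_) (sym (length-elems (Vec.lookup S k))) (proj₁ (sizes k))
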